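{- Let $k$ and $n$ be positive integers with $1<k\le n$. Suppose there exists an odd prime $p>2k+6$ such that $\frac{n}{k+3}<p\le\frac{n}{k}$ and $p\nmid (3k^2+11k+9)(k^2+5k+5)$. Then $S_k(n)$ is not an integer.
   Context: For positive integers $n$ and $k\le n$, $S_k(n)$ denotes the $k$-th elementary symmetric function of $1,1/3,\dots,1/(2n-1)$, i.e. $S_k(n)=\sum_{0\le i_1<\dots<i_k\le n-1}\prod_{j=1}^k \frac{1}{1+2i_j}$. -}

module Defs where

open import Data.Nat using (ℕ; zero; suc)
import Data.Nat as ℕ
open import Data.Integer using (ℤ; +_)
open import Data.Rational using (ℚ; _/_; _+_; _*_; 0ℚ; 1ℚ)
open import Data.List using (List; []; _∷_; map; upTo)

esym : ℕ → List ℚ → ℚ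
esym zero    _        = 1ℚ
esym (suc k) []       = 0ℚ
esym (suc k) (x ∷ xs) = esym (suc k) xs + x * esym k xs

oddRecips : ℕ → List ℚ
oddRecips n = map (λ i → + 1 / suc (2 ℕ.* i)) (upTo n)

S : ℕ → ℕ → ℚ
S k n = esym k (oddRecips n)

IsInteger : ℚ → Set
IsInteger q = Data.Product.∃ λ (z : ℤ) → q Relation.Binary.PropositionalEquality.≡ z / 1
  where import Data.Product
        import Relation.Binary.PropositionalEquality

module Submission where

-- Over the common denominator P = 1 · 3 ⋯ (2n − 1), the numerator of S_k(n) is the sum, over the
-- k-element sets of odd numbers below 2n, of the product of the n − k remaining ones. The prime p is
-- odd, so the odd multiples of p below 2n are p · 1, p · 3, …, p · (2m − 1), and kp ≤ n < (k + 3)p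
-- gives k ≤ m ≤ k + 3. Each term of the numerator leaves out at most k of these multiples, so it is
-- divisible by p ^ (m − k), and modulo p ^ (m − k + 1) the numerator is
-- p ^ (m − k) · e_(m−k)(1, 3, …, 2m − 1) · R, with R the product of the odd numbers prime to p.
-- As p ^ m divides P and k ≥ 1, integrality of S_k(n) forces p ∣ e_i(1, 3, …, 2(k + i) − 1) for
-- some i ≤ 3. These are 1, (k + 1)², (k + 1)(k + 2)(3k² + 11k + 9)/6 and
-- (k + 1)(k + 2)(k + 3)²(k² + 5k + 5)/6, none of which p > 2k + 6 divides.

open import Defs
open import Data.Nat as ℕ
  using (ℕ; zero; suc; _+_; _*_; _^_; _∸_; _≤_; _<_; z≤n; s≤s; NonZero; nonTrivial⇒≢1)
open import Data.Nat.Properties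
open import Data.Nat.Divisibility
  using (_∣_; _∤_; _∣?_; divides; >⇒∤; ∣-trans; ∣1⇒≡1; m∣m*n; n∣m*n; ∣m⇒∣m*n; ∣n⇒∣m*n; *-cancelˡ-∣; ∣m+n∣m⇒∣n)
open import Data.Nat.ListAction using (product)
open import Data.Nat.Primality using (Prime; euclidsLemma; prime⇒nonTrivial; prime⇒nonZero; prime⇒irreducible)
open import Data.Nat.DivMod using (_%_; m%n<n; m≡m%n+[m/n]*n)
open import Data.Nat.Tactic.RingSolver using (solve-∀)
open import Data.Integer as ℤ using (+_)
import Data.Integer.Properties as ℤₚ
import Data.Integer.Tactic.RingSolver as ℤ-Solver
open import Data.Rational as ℚ using (ℚ; _/_; 1ℚ; toℚᵘ)
import Data.Rational.Properties as ℚₚ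
open import Data.Rational.Solver using (module +-*-Solver)
open import Data.Rational.Unnormalised as ℚᵘ using (mkℚᵘ; *≡*)
import Data.Rational.Unnormalised.Properties as ℚᵘₚ
open import Data.List using (List; []; _∷_; _++_; [_]; _∷ʳ_; length; map; upTo)
open import Data.List.Properties using (length-++; ++-identityʳ; map-∘; map-++; upTo-∷ʳ)
open import Data.Product using (∃; _×_; _,_)
open import Data.Sum using ([_,_]′)
open import Data.Empty using (⊥-elim)
open import Function using (id; _∘_; flip)
open import Relation.Nullary using (¬_; yes; no)
open import Relation.Binary.PropositionalEquality hiding ([_])

esymℕ : ℕ → List ℕ → ℕ
esymℕ zero    _        = 1
esymℕ (suc i) []       = 0
esymℕ (suc i) (x ∷ xs) = esymℕ (suc i) xs + x * esymℕ i xs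

-- coesym k xs = e_(length xs ∸ k) xs: each k-element subset contributes the product of its complement.
coesym : ℕ → List ℕ → ℕ
coesym zero    xs       = product xs
coesym (suc k) []       = 0
coesym (suc k) (x ∷ xs) = x * coesym (suc k) xs + coesym k xs

esymℕ-length< : ∀ {i} xs → length xs < i → esymℕ i xs ≡ 0
esymℕ-length< {suc i} []       _         = refl
esymℕ-length< {suc i} (x ∷ xs) (s≤s len<i)
  rewrite esymℕ-length< xs (m≤n⇒m≤1+n len<i) | esymℕ-length< xs len<i = *-zeroʳ x

esymℕ-∷ʳ : ∀ i xs y → esymℕ (suc i) (xs ∷ʳ y) ≡ esymℕ (suc i) xs + y * esymℕ i xs
esymℕ-∷ʳ i       []       y = refl
esymℕ-∷ʳ zero    (x ∷ xs) y rewrite esymℕ-∷ʳ 0 xs y = lemma (esymℕ 1 xs) x y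
  where lemma : ∀ e x y → e + y * 1 + x * 1 ≡ e + x * 1 + y * 1
        lemma = solve-∀
esymℕ-∷ʳ (suc i) (x ∷ xs) y rewrite esymℕ-∷ʳ (suc i) xs y | esymℕ-∷ʳ i xs y =
  lemma (esymℕ (2 + i) xs) (esymℕ (suc i) xs) (esymℕ i xs) x y
  where lemma : ∀ a b c x y → a + y * b + x * (b + y * c) ≡ a + x * b + y * (b + x * c)
        lemma = solve-∀

fromℕ : ℕ → ℚ
fromℕ n = + n / 1

recip : ℕ → ℚ
recip d = + 1 / suc d

toℚᵘ-/1 : ∀ z → toℚᵘ (z / 1) ℚᵘ.≃ mkℚᵘ z 0
toℚᵘ-/1 z = ℚₚ.toℚᵘ-fromℚᵘ (mkℚᵘ z 0)

/1-injective : ∀ {a b} → a / 1 ≡ b / 1 → a ≡ b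
/1-injective {a} {b} a/1≡b/1 = ≃⇒≡ (begin
  mkℚᵘ a 0     ≈⟨ toℚᵘ-/1 a ⟨
  toℚᵘ (a / 1) ≡⟨ cong toℚᵘ a/1≡b/1 ⟩
  toℚᵘ (b / 1) ≈⟨ toℚᵘ-/1 b ⟩
  mkℚᵘ b 0     ∎)
  where
  open ℚᵘₚ.≃-Reasoning
  ≃⇒≡ : mkℚᵘ a 0 ℚᵘ.≃ mkℚᵘ b 0 → a ≡ b
  ≃⇒≡ (*≡* a*1≡b*1) = trans (sym (ℤₚ.*-identityʳ a)) (trans a*1≡b*1 (ℤₚ.*-identityʳ b))

/1-homo-+ : ∀ a b → (a ℤ.+ b) / 1 ≡ (a / 1) ℚ.+ (b / 1)
/1-homo-+ a b = ℚₚ.toℚᵘ-injective (begin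
  toℚᵘ ((a ℤ.+ b) / 1)           ≈⟨ toℚᵘ-/1 (a ℤ.+ b) ⟩
  mkℚᵘ (a ℤ.+ b) 0               ≈⟨ *≡* (lemma a b) ⟩
  mkℚᵘ a 0 ℚᵘ.+ mkℚᵘ b 0         ≈⟨ ℚᵘₚ.+-cong (toℚᵘ-/1 a) (toℚᵘ-/1 b) ⟨
  toℚᵘ (a / 1) ℚᵘ.+ toℚᵘ (b / 1) ≈⟨ ℚₚ.toℚᵘ-homo-+ (a / 1) (b / 1) ⟨
  toℚᵘ ((a / 1) ℚ.+ (b / 1))     ∎)
  where
  open ℚᵘₚ.≃-Reasoning
  lemma : ∀ a b → (a ℤ.+ b) ℤ.* + 1 ≡ (a ℤ.* + 1 ℤ.+ b ℤ.* + 1) ℤ.* + 1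
  lemma = ℤ-Solver.solve-∀

/1-homo-* : ∀ a b → (a ℤ.* b) / 1 ≡ (a / 1) ℚ.* (b / 1)
/1-homo-* a b = ℚₚ.toℚᵘ-injective (begin
  toℚᵘ ((a ℤ.* b) / 1)           ≈⟨ toℚᵘ-/1 (a ℤ.* b) ⟩
  mkℚᵘ (a ℤ.* b) 0               ≡⟨⟩
  mkℚᵘ a 0 ℚᵘ.* mkℚᵘ b 0         ≈⟨ ℚᵘₚ.*-cong (toℚᵘ-/1 a) (toℚᵘ-/1 b) ⟨
  toℚᵘ (a / 1) ℚᵘ.* toℚᵘ (b / 1) ≈⟨ ℚₚ.toℚᵘ-homo-* (a / 1) (b / 1) ⟨
  toℚᵘ ((a / 1) ℚ.* (b / 1))     ∎)
  where open ℚᵘₚ.≃-Reasoning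

fromℕ-homo-+ : ∀ m n → fromℕ (m + n) ≡ fromℕ m ℚ.+ fromℕ n
fromℕ-homo-+ m n = trans (cong (_/ 1) (ℤₚ.pos-+ m n)) (/1-homo-+ (+ m) (+ n))

fromℕ-homo-* : ∀ m n → fromℕ (m * n) ≡ fromℕ m ℚ.* fromℕ n
fromℕ-homo-* m n = trans (cong (_/ 1) (ℤₚ.pos-* m n)) (/1-homo-* (+ m) (+ n))

recip-inverse : ∀ d → recip d ℚ.* fromℕ (suc d) ≡ 1ℚ
recip-inverse d = ℚₚ.toℚᵘ-injective (begin
  toℚᵘ (recip d ℚ.* fromℕ (suc d))         ≈⟨ ℚₚ.toℚᵘ-homo-* (recip d) (fromℕ (suc d)) ⟩
  toℚᵘ (recip d) ℚᵘ.* toℚᵘ (fromℕ (suc d))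
    ≈⟨ ℚᵘₚ.*-cong (ℚₚ.toℚᵘ-fromℚᵘ (mkℚᵘ (+ 1) d)) (toℚᵘ-/1 (+ suc d)) ⟩
  mkℚᵘ (+ 1) d ℚᵘ.* mkℚᵘ (+ suc d) 0       ≈⟨ *≡* cross ⟩
  toℚᵘ 1ℚ                                  ∎)
  where
  open ℚᵘₚ.≃-Reasoning
  cross : (+ 1 ℤ.* + suc d) ℤ.* + 1 ≡ + 1 ℤ.* + (suc d * 1)
  cross rewrite *-identityʳ d = ℤₚ.*-identityʳ (+ 1 ℤ.* + suc d)

esym-recip-*-product : ∀ k ds →
  esym k (map recip ds) ℚ.* fromℕ (product (map suc ds)) ≡ fromℕ (coesym k (map suc ds))
esym-recip-*-product zero    ds       = ℚₚ.*-identityˡ _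
esym-recip-*-product (suc k) []       = ℚₚ.*-zeroˡ (fromℕ 1)
esym-recip-*-product (suc k) (d ∷ ds) = begin
  (a ℚ.+ r ℚ.* b) ℚ.* fromℕ (suc d * P)
    ≡⟨ cong ((a ℚ.+ r ℚ.* b) ℚ.*_) (fromℕ-homo-* (suc d) P) ⟩
  (a ℚ.+ r ℚ.* b) ℚ.* (x ℚ.* fromℕ P)
    ≡⟨ rearrange a r b x (fromℕ P) ⟩
  x ℚ.* (a ℚ.* fromℕ P) ℚ.+ (r ℚ.* x) ℚ.* (b ℚ.* fromℕ P)
    ≡⟨ cong₂ (λ u v → x ℚ.* u ℚ.+ v ℚ.* (b ℚ.* fromℕ P))
             (esym-recip-*-product (suc k) ds) (recip-inverse d) ⟩
  x ℚ.* fromℕ (coesym (suc k) xs) ℚ.+ 1ℚ ℚ.* (b ℚ.* fromℕ P)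
    ≡⟨ cong (x ℚ.* fromℕ (coesym (suc k) xs) ℚ.+_) (ℚₚ.*-identityˡ (b ℚ.* fromℕ P)) ⟩
  x ℚ.* fromℕ (coesym (suc k) xs) ℚ.+ b ℚ.* fromℕ P
    ≡⟨ cong₂ ℚ._+_ (sym (fromℕ-homo-* (suc d) (coesym (suc k) xs))) (esym-recip-*-product k ds) ⟩
  fromℕ (suc d * coesym (suc k) xs) ℚ.+ fromℕ (coesym k xs)
    ≡⟨ fromℕ-homo-+ (suc d * coesym (suc k) xs) (coesym k xs) ⟨
  fromℕ (suc d * coesym (suc k) xs + coesym k xs)
    ∎
  where
  open ≡-Reasoning
  open +-*-Solver
  xs = map suc ds
  P  = product xs
  a  = esym (suc k) (map recip ds)
  b  = esym k (map recip ds)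
  r  = recip d
  x  = fromℕ (suc d)
  rearrange : ∀ a r b x y →
              (a ℚ.+ r ℚ.* b) ℚ.* (x ℚ.* y) ≡ x ℚ.* (a ℚ.* y) ℚ.+ (r ℚ.* x) ℚ.* (b ℚ.* y)
  rearrange = solve 5 (λ a r b x y → (a :+ r :* b) :* (x :* y) := x :* (a :* y) :+ (r :* x) :* (b :* y)) refl

prime∤1 : ∀ {p} → Prime p → p ∤ 1
prime∤1 pp = nonTrivial⇒≢1 {{prime⇒nonTrivial pp}} ∘ ∣1⇒≡1

prime∤* : ∀ {p a b} → Prime p → p ∤ a → p ∤ b → p ∤ a * b
prime∤* pp p∤a p∤b = [ p∤a , p∤b ]′ ∘ euclidsLemma _ _ pp

module PAdicSplit (p : ℕ) where

  quotients : List ℕ → List ℕ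
  quotients []       = []
  quotients (x ∷ xs) with p ∣? x
  ... | yes (divides q _) = q ∷ quotients xs
  ... | no _              = quotients xs

  nonMultiples : List ℕ → List ℕ
  nonMultiples []       = []
  nonMultiples (x ∷ xs) with p ∣? x
  ... | yes _ = nonMultiples xs
  ... | no _  = x ∷ nonMultiples xs

  quotients-++ : ∀ xs ys → quotients (xs ++ ys) ≡ quotients xs ++ quotients ys
  quotients-++ []       ys = refl
  quotients-++ (x ∷ xs) ys with p ∣? x
  ... | yes (divides q _) = cong (q ∷_) (quotients-++ xs ys)
  ... | no _              = quotients-++ xs ys

  p^length∣product : ∀ xs → p ^ length (quotients xs) ∣ product xs
  p^length∣product []       = divides 1 refl
  p^length∣product (x ∷ xs) with p ∣? x
  ... | no _ = ∣-trans (p^length∣product xs) (n∣m*n x)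
  ... | yes (divides q refl) with p^length∣product xs
  ...   | divides c eq = divides (q * c) (trans (cong (q * p *_) eq) (lemma q p c (p ^ length (quotients xs))))
    where lemma : ∀ q p c a → q * p * (c * a) ≡ q * c * (p * a)
          lemma = solve-∀

  prime∤product-nonMultiples : Prime p → ∀ xs → p ∤ product (nonMultiples xs)
  prime∤product-nonMultiples pp []       = prime∤1 pp
  prime∤product-nonMultiples pp (x ∷ xs) with p ∣? x
  ... | yes _  = prime∤product-nonMultiples pp xs
  ... | no p∤x = prime∤* pp p∤x (prime∤product-nonMultiples pp xs)

  record LowestTerm (i a n : ℕ) : Set where
    constructor lowestTerm
    field
      higher    : ℕ
      expansion : n ≡ p ^ i * (a + p * higher)

  lowestTerm-cong : ∀ {i a b n} → a ≡ b → LowestTerm i a n → LowestTerm i b n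
  lowestTerm-cong refl t = t

  lowestTerm-self : ∀ i a → LowestTerm i a (p ^ i * a)
  lowestTerm-self i a = lowestTerm 0 (lemma (p ^ i) a p)
    where lemma : ∀ c a p → c * a ≡ c * (a + p * 0)
          lemma = solve-∀

  lowestTerm-multiple : ∀ {n} → p ∣ n → LowestTerm 0 0 n
  lowestTerm-multiple (divides w refl) = lowestTerm w (sym (trans (*-identityˡ (p * w)) (*-comm p w)))

  lowestTerm-*ˡ : ∀ {i a n} c → LowestTerm i a n → LowestTerm i (c * a) (c * n)
  lowestTerm-*ˡ {i} {a} c (lowestTerm w refl) = lowestTerm (c * w) (lemma c (p ^ i) a p w)
    where lemma : ∀ c b a p w → c * (b * (a + p * w)) ≡ b * (c * a + p * (c * w))
          lemma = solve-∀

  lowestTerm-+ : ∀ {i a b m n} → LowestTerm i a m → LowestTerm i b n → LowestTerm i (a + b) (m + n)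
  lowestTerm-+ {i} {a} {b} (lowestTerm v refl) (lowestTerm w refl) = lowestTerm (v + w) (lemma (p ^ i) a b p v w)
    where lemma : ∀ c a b p v w → c * (a + p * v) + c * (b + p * w) ≡ c * (a + b + p * (v + w))
          lemma = solve-∀

  lowestTerm-weaken : ∀ {i a n} → LowestTerm (suc i) a n → LowestTerm i 0 n
  lowestTerm-weaken {i} {a} (lowestTerm w refl) = lowestTerm (a + p * w) (lemma p (p ^ i) a w)
    where lemma : ∀ p c a w → p * c * (a + p * w) ≡ c * (p * (a + p * w))
          lemma = solve-∀

  lowestTerm-*-multiple : ∀ {i a n} x q → x ≡ q * p → LowestTerm i a n → LowestTerm (suc i) (q * a) (x * n)
  lowestTerm-*-multiple {i} {a} x q refl (lowestTerm w refl) = lowestTerm (q * w) (lemma q p (p ^ i) a w)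
    where lemma : ∀ q p c a w → q * p * (c * (a + p * w)) ≡ p * c * (q * a + p * (q * w))
          lemma = solve-∀

  lowestTerm⇒∣ : ∀ {i a n} .{{_ : NonZero p}} → LowestTerm i a n → p ^ suc i ∣ n → p ∣ a
  lowestTerm⇒∣ {i} {a} {n} (lowestTerm w refl) p^[1+i]∣n = ∣m+n∣m⇒∣n p∣p*w+a (m∣m*n w)
    where
    p∣p*w+a : p ∣ p * w + a
    p∣p*w+a = *-cancelˡ-∣ (p ^ i) {{m^n≢0 p i}}
      (subst₂ _∣_ (*-comm p (p ^ i)) (cong (p ^ i *_) (+-comm a (p * w))) p^[1+i]∣n)

  coesym-lowestTerm : ∀ xs j i → j + i ≡ length (quotients xs) →
    LowestTerm i (esymℕ i (quotients xs) * product (nonMultiples xs)) (coesym j xs)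
  coesym-lowestTerm []       zero    zero    refl = lowestTerm-self 0 1
  coesym-lowestTerm []       zero    (suc i) ()
  coesym-lowestTerm []       (suc j) i       ()
  coesym-lowestTerm (x ∷ xs) j       i       len with p ∣? x
  coesym-lowestTerm (x ∷ xs) zero    i       len | no _ =
    lowestTerm-cong (lemma x (esymℕ i (quotients xs)) (product (nonMultiples xs)))
      (lowestTerm-*ˡ x (coesym-lowestTerm xs 0 i len))
    where lemma : ∀ x e r → x * (e * r) ≡ e * (x * r)
          lemma = solve-∀
  coesym-lowestTerm (x ∷ xs) (suc j) i       len | no _ =
    lowestTerm-cong (lemma x (esymℕ i (quotients xs)) (product (nonMultiples xs)))
      (lowestTerm-+ (lowestTerm-*ˡ x (coesym-lowestTerm xs (suc j) i len))
                    (lowestTerm-weaken (coesym-lowestTerm xs j (suc i) (trans (+-suc j i) len))))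
    where lemma : ∀ x e r → x * (e * r) + 0 ≡ e * (x * r)
          lemma = solve-∀
  coesym-lowestTerm (x ∷ xs) zero    (suc i) len | yes (divides q x≡qp) =
    lowestTerm-cong (trans (lemma q e r) (cong (λ e′ → (e′ + q * e) * r) (sym eₛᵤ꜀ᵢ≡0)))
      (lowestTerm-*-multiple x q x≡qp (coesym-lowestTerm xs 0 i (suc-injective len)))
    where
    e = esymℕ i (quotients xs)
    r = product (nonMultiples xs)
    eₛᵤ꜀ᵢ≡0 : esymℕ (suc i) (quotients xs) ≡ 0
    eₛᵤ꜀ᵢ≡0 = esymℕ-length< (quotients xs) (≤-reflexive (sym len))
    lemma : ∀ q e r → q * (e * r) ≡ (0 + q * e) * r
    lemma = solve-∀
  coesym-lowestTerm (x ∷ xs) (suc j) zero    len | yes (divides q x≡qp) =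
    lowestTerm-+ (lowestTerm-multiple (∣-trans (divides q x≡qp) (m∣m*n (coesym (suc j) xs))))
                 (coesym-lowestTerm xs j 0 (suc-injective len))
  coesym-lowestTerm (x ∷ xs) (suc j) (suc i) len | yes (divides q x≡qp) =
    lowestTerm-cong (lemma q (esymℕ i (quotients xs)) (esymℕ (suc i) (quotients xs))
                           (product (nonMultiples xs)))
      (lowestTerm-+ (lowestTerm-*-multiple x q x≡qp (coesym-lowestTerm xs (suc j) i len′))
                    (coesym-lowestTerm xs j (suc i) (suc-injective len)))
    where
    len′ : suc j + i ≡ length (quotients xs)
    len′ = trans (sym (+-suc j i)) (suc-injective len)
    lemma : ∀ q e e′ r → q * (e * r) + e′ * r ≡ (e′ + q * e) * r
    lemma = solve-∀

  prime∣esymℕ-quotients : Prime p → ∀ xs i j → length (quotients xs) ≡ i + suc j →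
    product xs ∣ coesym (suc j) xs → p ∣ esymℕ i (quotients xs)
  prime∣esymℕ-quotients pp xs i j len P∣coesym =
    [ id , ⊥-elim ∘ prime∤product-nonMultiples pp xs ]′
      (euclidsLemma _ _ pp (lowestTerm⇒∣ {{prime⇒nonZero pp}} expansion p^[1+i]∣coesym))
    where
    expansion : LowestTerm i (esymℕ i (quotients xs) * product (nonMultiples xs)) (coesym (suc j) xs)
    expansion = coesym-lowestTerm xs (suc j) i (trans (cong suc (+-comm j i)) (sym (trans len (+-suc i j))))
    p^[1+i]∣p^length : p ^ suc i ∣ p ^ length (quotients xs)
    p^[1+i]∣p^length = divides (p ^ j) (begin
      p ^ length (quotients xs) ≡⟨ cong (p ^_) (trans len (+-suc i j)) ⟩
      p ^ (suc i + j)           ≡⟨ ^-distribˡ-+-* p (suc i) j ⟩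
      p ^ suc i * p ^ j         ≡⟨ *-comm (p ^ suc i) (p ^ j) ⟩
      p ^ j * p ^ suc i         ∎)
      where open ≡-Reasoning
    p^[1+i]∣coesym : p ^ suc i ∣ coesym (suc j) xs
    p^[1+i]∣coesym = ∣-trans p^[1+i]∣p^length (∣-trans (p^length∣product xs) P∣coesym)

odds : ℕ → List ℕ
odds zero    = []
odds (suc m) = odds m ∷ʳ suc (2 * m)

length-odds : ∀ m → length (odds m) ≡ m
length-odds zero    = refl
length-odds (suc m) = trans (length-++ (odds m)) (trans (cong (_+ 1) (length-odds m)) (+-comm m 1))

oddMultipleCount-bounds : ∀ p .{{_ : NonZero p}} k n m → p * k ≤ n → n < p * (k + 3) →
  2 * m * p < 2 * n + p → 2 * n < suc (2 * m) * p → k ≤ m × m ≤ k + 3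
oddMultipleCount-bounds p k n m pk≤n n<p[k+3] lower upper =
  *-cancelˡ-≤ 2 (≤-pred (*-cancelʳ-< p (2 * k) (suc (2 * m)) 2kp<[2m+1]p)) ,
  *-cancelˡ-≤ 2 (≤-pred (*-cancelʳ-< p (2 * m) (suc (2 * (k + 3))) 2mp<[2k+7]p))
  where
  open ≤-Reasoning
  2kp<[2m+1]p : 2 * k * p < suc (2 * m) * p
  2kp<[2m+1]p = begin-strict
    2 * k * p   ≡⟨ *-assoc 2 k p ⟩
    2 * (k * p) ≡⟨ cong (2 *_) (*-comm k p) ⟩
    2 * (p * k) ≤⟨ *-monoʳ-≤ 2 pk≤n ⟩
    2 * n       <⟨ upper ⟩
    suc (2 * m) * p ∎
  2mp<[2k+7]p : 2 * m * p < suc (2 * (k + 3)) * p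
  2mp<[2k+7]p = begin-strict
    2 * m * p                 <⟨ lower ⟩
    2 * n + p                 <⟨ +-monoˡ-< p (*-monoʳ-< 2 n<p[k+3]) ⟩
    2 * (p * (k + 3)) + p     ≡⟨ lemma p (k + 3) ⟩
    suc (2 * (k + 3)) * p     ∎
    where lemma : ∀ p a → 2 * (p * a) + p ≡ suc (2 * a) * p
          lemma = solve-∀

module OddMultiples (h : ℕ) where

  p : ℕ
  p = suc (2 * h)

  open PAdicSplit p

  quotient-next : ∀ m n q → 2 * m * p < 2 * n + p → 2 * n < suc (2 * m) * p →
                  suc (2 * n) ≡ q * p → q ≡ suc (2 * m)
  quotient-next m n q lower upper 2n+1≡qp =
    [ ≤-antisym q≤2m+1 , ⊥-elim ∘ even≢odd (m * p) n ∘ 2mp≡2n+1 ]′ (m≤n⇒m<n∨m≡n 2m≤q)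
    where
    open ≤-Reasoning
    q≤2m+1 : q ≤ suc (2 * m)
    q≤2m+1 = *-cancelʳ-≤ q (suc (2 * m)) p (subst (_≤ suc (2 * m) * p) 2n+1≡qp upper)
    2m≤q : 2 * m ≤ q
    2m≤q = ≤-pred (*-cancelʳ-< p (2 * m) (suc q) (begin-strict
      2 * m * p      <⟨ lower ⟩
      2 * n + p      <⟨ +-monoˡ-< p (n<1+n (2 * n)) ⟩
      suc (2 * n) + p ≡⟨ cong (_+ p) 2n+1≡qp ⟩
      q * p + p      ≡⟨ +-comm (q * p) p ⟩
      suc q * p      ∎))
    2mp≡2n+1 : 2 * m ≡ q → 2 * (m * p) ≡ suc (2 * n)
    2mp≡2n+1 2m≡q = trans (sym (*-assoc 2 m p)) (trans (cong (_* p) 2m≡q) (sym 2n+1≡qp))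

  -- The bounds say (2m − 1)p < 2n < (2m + 1)p: the odd multiples of p below 2n are p · odds m.
  quotients-odds : ∀ n → ∃ λ m →
    quotients (odds n) ≡ odds m × 2 * m * p < 2 * n + p × 2 * n < suc (2 * m) * p
  quotients-odds zero    = 0 , refl , s≤s z≤n , s≤s z≤n
  quotients-odds (suc n) with quotients-odds n
  ... | m , quotients≡ , lower , upper
    rewrite quotients-++ (odds n) [ suc (2 * n) ] | quotients≡ with p ∣? suc (2 * n)
  ... | yes (divides q 2n+1≡qp) = suc m , cong (odds m ∷ʳ_) q≡2m+1 , lower′ , upper′
    where
    open ≤-Reasoning
    q≡2m+1 : q ≡ suc (2 * m)
    q≡2m+1 = quotient-next m n q lower upper 2n+1≡qp
    2n+1≡[2m+1]p : suc (2 * n) ≡ suc (2 * m) * p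
    2n+1≡[2m+1]p = trans 2n+1≡qp (cong (_* p) q≡2m+1)
    lower′ : 2 * suc m * p < 2 * suc n + p
    lower′ = begin-strict
      2 * suc m * p         ≡⟨ lemma m p ⟩
      suc (2 * m) * p + p   ≡⟨ cong (_+ p) 2n+1≡[2m+1]p ⟨
      suc (2 * n) + p       <⟨ +-monoˡ-< p (n<1+n (suc (2 * n))) ⟩
      suc (suc (2 * n)) + p ≡⟨ cong (_+ p) (*-suc 2 n) ⟨
      2 * suc n + p         ∎
      where lemma : ∀ m p → 2 * suc m * p ≡ suc (2 * m) * p + p
            lemma = solve-∀
    upper′ : 2 * suc n < suc (2 * suc m) * p
    upper′ = begin-strict
      2 * suc n               ≡⟨ trans (*-suc 2 n) (+-comm 2 (2 * n)) ⟩
      2 * n + 2               <⟨ s≤s (+-monoʳ-≤ (2 * n) (*-monoʳ-≤ 2 (s≤s z≤n))) ⟩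
      suc (2 * n) + 2 * p     ≡⟨ cong (_+ 2 * p) 2n+1≡[2m+1]p ⟩
      suc (2 * m) * p + 2 * p ≡⟨ lemma m p ⟩
      suc (2 * suc m) * p     ∎
      where lemma : ∀ m p → suc (2 * m) * p + 2 * p ≡ suc (2 * suc m) * p
            lemma = solve-∀
  ... | no p∤2n+1 = m , ++-identityʳ (odds m) , lower′ , upper′
    where
    lower′ : 2 * m * p < 2 * suc n + p
    lower′ = <-≤-trans lower (+-monoˡ-≤ p (*-monoʳ-≤ 2 (n≤1+n n)))
    [2m+1]p-odd : suc (2 * m) * p ≡ suc (2 * (2 * m * h + m + h))
    [2m+1]p-odd = lemma m h
      where lemma : ∀ m h → suc (2 * m) * suc (2 * h) ≡ suc (2 * (2 * m * h + m + h))
            lemma = solve-∀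
    2n+1<[2m+1]p : suc (2 * n) < suc (2 * m) * p
    2n+1<[2m+1]p = ≤∧≢⇒< upper (p∤2n+1 ∘ divides (suc (2 * m)))
    upper′ : 2 * suc n < suc (2 * m) * p
    upper′ = subst (_< suc (2 * m) * p) (sym (*-suc 2 n))
      (≤∧≢⇒< 2n+1<[2m+1]p
        (even≢odd (suc n) (2 * m * h + m + h) ∘ trans (*-suc 2 n) ∘ flip trans [2m+1]p-odd))

  quotients-odds-window : ∀ k n → p * k ≤ n → n < p * (k + 3) →
    ∃ λ i → i ≤ 3 × quotients (odds n) ≡ odds (i + k)
  quotients-odds-window k n pk≤n n<p[k+3] with quotients-odds n
  ... | m , quotients≡ , lower , upper with oddMultipleCount-bounds p k n m pk≤n n<p[k+3] lower upper
  ...   | k≤m , m≤k+3 =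
    m ∸ k ,
    ≤-trans (∸-monoˡ-≤ k m≤k+3) (≤-reflexive (m+n∸m≡n k 3)) ,
    trans quotients≡ (cong odds (sym (m∸n+n≡m k≤m)))

esymℕ-1-odds : ∀ m → esymℕ 1 (odds m) ≡ m * m
esymℕ-1-odds zero    = refl
esymℕ-1-odds (suc m) = begin
  esymℕ 1 (odds m ∷ʳ suc (2 * m))     ≡⟨ esymℕ-∷ʳ 0 (odds m) (suc (2 * m)) ⟩
  esymℕ 1 (odds m) + suc (2 * m) * 1 ≡⟨ cong (_+ suc (2 * m) * 1) (esymℕ-1-odds m) ⟩
  m * m + suc (2 * m) * 1             ≡⟨ lemma m ⟩
  suc m * suc m                       ∎
  where
  open ≡-Reasoning
  lemma : ∀ m → m * m + suc (2 * m) * 1 ≡ suc m * suc m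
  lemma = solve-∀

esymℕ-2-odds : ∀ k → 6 * esymℕ 2 (odds (2 + k)) ≡ (2 + k) * (1 + k) * (3 * k * k + 11 * k + 9)
esymℕ-2-odds zero    = refl
esymℕ-2-odds (suc k) = begin
  6 * esymℕ 2 (odds (2 + k) ∷ʳ x)                 ≡⟨ cong (6 *_) (esymℕ-∷ʳ 1 (odds (2 + k)) x) ⟩
  6 * (esymℕ 2 (odds (2 + k)) + x * esymℕ 1 (odds (2 + k)))
    ≡⟨ *-distribˡ-+ 6 (esymℕ 2 (odds (2 + k))) _ ⟩
  6 * esymℕ 2 (odds (2 + k)) + 6 * (x * esymℕ 1 (odds (2 + k)))
    ≡⟨ cong₂ (λ a b → a + 6 * (x * b)) (esymℕ-2-odds k) (esymℕ-1-odds (2 + k)) ⟩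
  (2 + k) * (1 + k) * (3 * k * k + 11 * k + 9) + 6 * (x * ((2 + k) * (2 + k)))
    ≡⟨ lemma k ⟩
  (3 + k) * (2 + k) * (3 * suc k * suc k + 11 * suc k + 9) ∎
  where
  open ≡-Reasoning
  x = suc (2 * (2 + k))
  lemma : ∀ k → (2 + k) * (1 + k) * (3 * k * k + 11 * k + 9) + 6 * (suc (2 * (2 + k)) * ((2 + k) * (2 + k)))
              ≡ (3 + k) * (2 + k) * (3 * suc k * suc k + 11 * suc k + 9)
  lemma = solve-∀

esymℕ-3-odds : ∀ k → 6 * esymℕ 3 (odds (3 + k)) ≡ (3 + k) * (3 + k) * (2 + k) * (1 + k) * (k * k + 5 * k + 5)
esymℕ-3-odds zero    = refl
esymℕ-3-odds (suc k) = begin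
  6 * esymℕ 3 (odds (3 + k) ∷ʳ x)                 ≡⟨ cong (6 *_) (esymℕ-∷ʳ 2 (odds (3 + k)) x) ⟩
  6 * (esymℕ 3 (odds (3 + k)) + x * esymℕ 2 (odds (3 + k)))
    ≡⟨ lemma₁ (esymℕ 3 (odds (3 + k))) x (esymℕ 2 (odds (3 + k))) ⟩
  6 * esymℕ 3 (odds (3 + k)) + x * (6 * esymℕ 2 (odds (3 + k)))
    ≡⟨ cong₂ (λ a b → a + x * b) (esymℕ-3-odds k) (esymℕ-2-odds (suc k)) ⟩
  (3 + k) * (3 + k) * (2 + k) * (1 + k) * (k * k + 5 * k + 5)
    + x * ((3 + k) * (2 + k) * (3 * suc k * suc k + 11 * suc k + 9))
    ≡⟨ lemma₂ k ⟩
  (4 + k) * (4 + k) * (3 + k) * (2 + k) * (suc k * suc k + 5 * suc k + 5) ∎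
  where
  open ≡-Reasoning
  x = suc (2 * (3 + k))
  lemma₁ : ∀ a x b → 6 * (a + x * b) ≡ 6 * a + x * (6 * b)
  lemma₁ = solve-∀
  lemma₂ : ∀ k → (3 + k) * (3 + k) * (2 + k) * (1 + k) * (k * k + 5 * k + 5)
                   + suc (2 * (3 + k)) * ((3 + k) * (2 + k) * (3 * suc k * suc k + 11 * suc k + 9))
               ≡ (4 + k) * (4 + k) * (3 + k) * (2 + k) * (suc k * suc k + 5 * suc k + 5)
  lemma₂ = solve-∀

prime∤esymℕ-odds : ∀ {p} → Prime p → ∀ k → 2 * k + 6 < p →
  p ∤ (3 * k * k + 11 * k + 9) * (k * k + 5 * k + 5) → ∀ i → i ≤ 3 → p ∤ esymℕ i (odds (i + k))
prime∤esymℕ-odds {p} pp k 2k+6<p p∤QU = λ where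
    zero _ → prime∤1 pp
    1    _ → prime∤* pp p∤1+k p∤1+k ∘ subst (p ∣_) (esymℕ-1-odds (1 + k))
    2    _ → prime∤* pp (prime∤* pp p∤2+k p∤1+k) p∤Q
             ∘ subst (p ∣_) (esymℕ-2-odds k) ∘ ∣n⇒∣m*n 6
    3    _ → prime∤* pp (prime∤* pp (prime∤* pp (prime∤* pp p∤3+k p∤3+k) p∤2+k) p∤1+k) p∤U
             ∘ subst (p ∣_) (esymℕ-3-odds k) ∘ ∣n⇒∣m*n 6
    (suc (suc (suc (suc _)))) (s≤s (s≤s (s≤s ())))
  where
  p∤Q : p ∤ 3 * k * k + 11 * k + 9
  p∤Q = p∤QU ∘ ∣m⇒∣m*n (k * k + 5 * k + 5)
  p∤U : p ∤ k * k + 5 * k + 5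
  p∤U = p∤QU ∘ ∣n⇒∣m*n (3 * k * k + 11 * k + 9)
  3+k<p : 3 + k < p
  3+k<p = ≤-<-trans (subst (3 + k ≤_) (+-comm 6 (2 * k)) (+-mono-≤ (m≤m+n 3 3) (m≤m+n k (k + 0)))) 2k+6<p
  p∤[1+a]+k : ∀ {a} → a ≤ 2 → p ∤ suc a + k
  p∤[1+a]+k a≤2 = >⇒∤ (≤-<-trans (+-monoˡ-≤ k (s≤s a≤2)) 3+k<p)
  p∤1+k : p ∤ 1 + k
  p∤1+k = p∤[1+a]+k z≤n
  p∤2+k : p ∤ 2 + k
  p∤2+k = p∤[1+a]+k (s≤s z≤n)
  p∤3+k : p ∤ 3 + k
  p∤3+k = p∤[1+a]+k (s≤s (s≤s z≤n))

map-suc-2*-upTo : ∀ n → map suc (map (2 *_) (upTo n)) ≡ odds n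
map-suc-2*-upTo zero    = refl
map-suc-2*-upTo (suc n) = begin
  map suc (map (2 *_) (upTo (suc n)))             ≡⟨ cong (map suc ∘ map (2 *_)) (upTo-∷ʳ n) ⟨
  map suc (map (2 *_) (upTo n ∷ʳ n))              ≡⟨ cong (map suc) (map-++ (2 *_) (upTo n) [ n ]) ⟩
  map suc (map (2 *_) (upTo n) ∷ʳ 2 * n)          ≡⟨ map-++ suc (map (2 *_) (upTo n)) [ 2 * n ] ⟩
  map suc (map (2 *_) (upTo n)) ∷ʳ suc (2 * n)    ≡⟨ cong (_∷ʳ suc (2 * n)) (map-suc-2*-upTo n) ⟩
  odds n ∷ʳ suc (2 * n)                           ∎
  where open ≡-Reasoning

integral-S⇒product∣coesym : ∀ k n → IsInteger (S k n) → product (odds n) ∣ coesym k (odds n)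
integral-S⇒product∣coesym k n (z , Sₖ≡z) =
  subst (λ xs → product xs ∣ coesym k xs) (map-suc-2*-upTo n) (divides ℤ.∣ z ∣ coesym≡∣z∣*P)
  where
  ds = map (2 *_) (upTo n)
  P  = product (map suc ds)
  z*P≡coesym : z ℤ.* + P ≡ + coesym k (map suc ds)
  z*P≡coesym = /1-injective (begin
    (z ℤ.* + P) / 1                       ≡⟨ /1-homo-* z (+ P) ⟩
    (z / 1) ℚ.* fromℕ P                   ≡⟨ cong (ℚ._* fromℕ P) (sym Sₖ≡z) ⟩
    S k n ℚ.* fromℕ P                     ≡⟨ cong (λ xs → esym k xs ℚ.* fromℕ P) (map-∘ (upTo n)) ⟩
    esym k (map recip ds) ℚ.* fromℕ P     ≡⟨ esym-recip-*-product k ds ⟩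
    fromℕ (coesym k (map suc ds))         ∎)
    where open ≡-Reasoning
  coesym≡∣z∣*P : coesym k (map suc ds) ≡ ℤ.∣ z ∣ * P
  coesym≡∣z∣*P = trans (cong ℤ.∣_∣ (sym z*P≡coesym)) (ℤₚ.abs-* z (+ P))

prime>2⇒odd : ∀ {p} → Prime p → 2 < p → ∃ λ h → p ≡ suc (2 * h)
prime>2⇒odd {p} pp 2<p with p % 2 | m%n<n p 2 | m≡m%n+[m/n]*n p 2
... | 0           | _            | p≡[p/2]*2 =
  ⊥-elim ([ (λ ()) , (λ 2≡p → <-irrefl 2≡p 2<p) ]′ (prime⇒irreducible pp 2∣p))
  where
  2∣p : 2 ∣ p
  2∣p = divides (p ℕ./ 2) p≡[p/2]*2
... | 1           | _            | p≡1+[p/2]*2 = p ℕ./ 2 , trans p≡1+[p/2]*2 (cong suc (*-comm (p ℕ./ 2) 2))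
... | suc (suc _) | s≤s (s≤s ()) | _

lemma2p4 : (k n : ℕ) → 1 < k → k ≤ n →
    (∃ λ p → Prime p × 2 * k + 6 < p × n < p * (k + 3) × p * k ≤ n ×
      ¬ (p ∣ (3 * k * k + 11 * k + 9) * (k * k + 5 * k + 5))) →
    ¬ IsInteger (S k n)
lemma2p4 zero      _ () _ _
lemma2p4 k@(suc j) n _  _ (p , p-prime , 2k+6<p , n<p[k+3] , pk≤n , p∤QU) integral
  with prime>2⇒odd p-prime (<-trans (≤-trans (m≤m+n 3 3) (m≤n+m 6 (2 * k))) 2k+6<p)
... | h , refl with OddMultiples.quotients-odds-window h k n pk≤n n<p[k+3]
...   | i , i≤3 , quotients≡ = prime∤esymℕ-odds p-prime k 2k+6<p p∤QU i i≤3 p∣esymᵢ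
  where
  open PAdicSplit p
  p∣esymᵢ : p ∣ esymℕ i (odds (i + k))
  p∣esymᵢ = subst (λ xs → p ∣ esymℕ i xs) quotients≡
    (prime∣esymℕ-quotients p-prime (odds n) i j
      (trans (cong length quotients≡) (length-odds (i + k)))
      (integral-S⇒product∣coesym k n integral))
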